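{- Let $r\geqslant 2$ and let $\pi,\sigma\in\mathrm{Sym}_n$ with $w_H(\pi)=2r-1\leqslant n$ and $w_H(\sigma)=r$. Then $\sigma\in N_3(\pi)$ if and only if $\sigma$ has a cycle $(y_1\,\ldots\,y_t)$ with $t\geqslant 2$ such that every other cycle of $\sigma$ is a cycle of $\pi$, and $\pi$ has a cycle $(y_1\,\ldots\,y_t\,y_{t+1}\,\ldots\,y_{t+s})$ for some $s\geqslant 1$.
   Context: $\mathrm{Sym}_n$ is the symmetric group on $[n]=\{1,\dots,n\}$, $w_H(\pi)=|\{i:\pi(i)\neq i\}|$ the Hamming weight. "Cycles" of a permutation mean its cycles of length at least two in its disjoint cycle decomposition. For $\pi\in\mathrm{Sym}_n$, $Tc(\pi)=\{(i,\pi(i)) : i\in[n],\ \pi(i)\neq i\}$. For $\pi$ with $w_H(\pi)=2r-1$, $N_3(\pi)=\{\sigma\in\mathrm{Sym}_n: |Tc(\sigma)\cap Tc(\pi)|=r-1,\ |Tc(\sigma)|=r\}$. -}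

module Defs where

open import Data.Nat using (ℕ; zero; suc; _≤_; _<?_)
open import Data.Fin using (Fin; zero; suc; toℕ; fromℕ<; _≟_)
open import Data.Fin.Permutation using (Permutation′; _⟨$⟩ʳ_)
open import Data.List using (List; length; filter; map; allFin)
open import Data.Product using (_×_; _,_)
open import Data.Product.Properties using (≡-dec)
open import Relation.Binary.PropositionalEquality using (_≡_; _≢_)
open import Relation.Nullary using (¬?)
open import Function.Definitions using (Injective)
import Data.List.Membership.DecPropositional as DecMem

Sym : ℕ → Set
Sym n = Permutation′ n

moved : ∀ {n} → Sym n → List (Fin n)
moved {n} π = filter (λ i → ¬? ((π ⟨$⟩ʳ i) ≟ i)) (allFin n)

wH : ∀ {n} → Sym n → ℕ
wH π = length (moved π)

Tc : ∀ {n} → Sym n → List (Fin n × Fin n)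
Tc π = map (λ i → (i , π ⟨$⟩ʳ i)) (moved π)

TcInterCard : ∀ {n} → Sym n → Sym n → ℕ
TcInterCard {n} σ π =
  length (filter (λ p → DecMem._∈?_ (≡-dec _≟_ _≟_) p (Tc π)) (Tc σ))

-- σ ∈ N₃(π)  (for w_H(π) = 2r-1):  |Tc σ ∩ Tc π| = r-1 and |Tc σ| = r
_∈N₃[_,_] : ∀ {n} → Sym n → Sym n → ℕ → Set
σ ∈N₃[ π , r ] = (TcInterCard σ π ≡ Data.Nat._∸_ r 1) × (length (Tc σ) ≡ r)

next : ∀ {t} → Fin t → Fin t
next {suc m} k with suc (toℕ k) <? suc m
... | Relation.Nullary.yes p = fromℕ< p
... | Relation.Nullary.no _ = zero

-- y = (y_0 ... y_{t-1}) is a cycle of σ (of length t ≥ 2):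
-- the y_k are distinct and σ(y_k) = y_{k+1 mod t}
IsCycle : ∀ {n t} → Sym n → (Fin t → Fin n) → Set
IsCycle {n} {t} σ y = (2 ≤ t) × Injective _≡_ _≡_ y × (∀ k → σ ⟨$⟩ʳ y k ≡ y (next k))

module Submission where

-- An arc (i, σ i) of σ lies in Tc π iff π i = σ i, so for w_H(σ) = r the condition σ ∈ N₃(π)
-- says that π and σ agree at every point moved by σ except exactly one, a.  Given such an a,
-- the σ-cycle read from σ a ends at a; π follows it up to a but then leaves it (π a ≠ σ a), so it
-- is an initial segment of a longer π-cycle, while every other σ-cycle avoids a and is a
-- π-cycle.  Conversely, in that situation the last point of the truncated cycle is the only
-- point moved by σ where π and σ disagree.

open import Defs
open import Data.Nat using (ℕ; zero; suc; _≤_; _<_; _+_; _*_; _∸_; z≤n; s≤s; s≤s⁻¹; z<s; _<?_)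
open import Data.Nat.Properties
  using (<-irrefl; <-cmp; ≤-refl; ≤-trans; ≤-<-trans; <⇒≤; ≤∧≢⇒<; ≰⇒>; m≤n⇒m<n∨m≡n; m≤n⇒∃[o]m+o≡n;
         n<1+n; n≤1+n; 1+n≢0; 1+n≢n; +-comm; +-suc; m≤m+n; +-monoʳ-≤;
         m+n∸m≡n; m+n∸n≡m; m∸[m∸n]≡n; m+[n∸m]≡n; m<n⇒0<n∸m; anyUpTo?)
open import Data.Nat.Induction using (<-rec)
open import Data.Fin using (Fin; zero; suc; toℕ; fromℕ; inject₁; _↑ˡ_; _≟_)
open import Data.Fin.Properties
  using (toℕ-injective; toℕ-fromℕ; toℕ-fromℕ<; toℕ<n; toℕ-↑ˡ; toℕ-inject₁; any?; pigeonhole)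
open import Data.Fin.Permutation using (_⟨$⟩ʳ_)
open import Data.List using ([]; _∷_; length; filter; map; allFin)
open import Data.List.Properties using (length-map; filter-≐; filter-accept; filter-reject; filter-none)
open import Data.List.Membership.Propositional using (_∈_)
import Data.List.Membership.DecPropositional as DecMem
open import Data.List.Membership.Propositional.Properties
  using (∈-filter⁺; ∈-filter⁻; ∈-map⁺; ∈-map⁻; ∈-allFin)
import Data.List.Relation.Unary.All as All
open import Data.List.Relation.Unary.Any using (here; there)
open import Data.List.Relation.Unary.Unique.Propositional using (Unique; _∷_)
open import Data.List.Relation.Unary.Unique.Propositional.Properties using (allFin⁺)
open import Data.Product using (Σ; ∃; _×_; _,_; proj₁; proj₂)
open import Data.Product.Properties using (≡-dec)
open import Data.Sum using (inj₁; inj₂)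
open import Function.Base using (_∘_)
open import Function.Bundles using (_⇔_; mk⇔; Injection; Equivalence)
open import Function.Properties.Inverse using (↔⇒↣)
open import Function.Construct.Composition using (_⇔-∘_)
open import Function.Definitions using (Injective)
open import Relation.Binary.Definitions using (DecidableEquality; tri<; tri≈; tri>)
open import Relation.Binary.PropositionalEquality
open import Relation.Nullary using (yes; no; ¬_; ¬?; contradiction)
open import Relation.Nullary.Decidable using (decidable-stable)
open import Relation.Unary using (Decidable)
open import Relation.Unary.Properties using (_∩?_; ∁?)

module _ {A : Set} where

  filter-filter : ∀ {P Q : A → Set} (P? : Decidable P) (Q? : Decidable Q) xs →
                  filter Q? (filter P? xs) ≡ filter (P? ∩? Q?) xs
  filter-filter P? Q? [] = refl
  filter-filter P? Q? (x ∷ xs) with P? x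
  ... | no _ = filter-filter P? Q? xs
  ... | yes _ with Q? x
  ...   | yes _ = cong (x ∷_) (filter-filter P? Q? xs)
  ...   | no _  = filter-filter P? Q? xs

  length-filter-split : ∀ {P Q : A → Set} (P? : Decidable P) (Q? : Decidable Q) xs →
                        length (filter P? xs) ≡
                        length (filter (P? ∩? Q?) xs) + length (filter (P? ∩? ∁? Q?) xs)
  length-filter-split P? Q? [] = refl
  length-filter-split P? Q? (x ∷ xs) with P? x
  ... | no _ = length-filter-split P? Q? xs
  ... | yes _ with Q? x
  ...   | yes _ = cong suc (length-filter-split P? Q? xs)
  ...   | no _  = trans (cong suc (length-filter-split P? Q? xs)) (sym (+-suc _ _))

  length-filter≡1⇒unique : ∀ {P : A → Set} (P? : Decidable P) xs → length (filter P? xs) ≡ 1 →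
                           ∃ λ a → P a × (∀ {x} → x ∈ xs → P x → x ≡ a)
  length-filter≡1⇒unique {P} P? xs eq with filter P? xs in e
  ... | a ∷ [] = a , proj₂ (∈-filter⁻ P? {xs = xs} (subst (a ∈_) (sym e) (here refl))) , only
    where
    only : ∀ {x} → x ∈ xs → P x → x ≡ a
    only x∈ Px with subst (_ ∈_) e (∈-filter⁺ P? x∈ Px)
    ... | here x≡a = x≡a

  length-filter-≟ : (_≟ᴬ_ : DecidableEquality A) → ∀ {a xs} → Unique xs → a ∈ xs →
                    length (filter (_≟ᴬ a) xs) ≡ 1
  length-filter-≟ _≟ᴬ_ {xs = x ∷ xs} (x∉ ∷ _) (here refl) =
    trans (cong length (filter-accept (_≟ᴬ x) refl))
          (cong (suc ∘ length) (filter-none (_≟ᴬ x) (All.map (λ x≢y y≡x → x≢y (sym y≡x)) x∉)))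
  length-filter-≟ _≟ᴬ_ {xs = x ∷ xs} (x∉ ∷ u) (there a∈) =
    trans (cong length (filter-reject (_≟ᴬ _) (All.lookup x∉ a∈)))
          (length-filter-≟ _≟ᴬ_ u a∈)

module _ {A B : Set} (f : A → B) where

  filter-map : ∀ {P : B → Set} (P? : Decidable P) xs →
               filter P? (map f xs) ≡ map f (filter (P? ∘ f) xs)
  filter-map P? [] = refl
  filter-map P? (x ∷ xs) with P? (f x)
  ... | yes _ = cong (f x ∷_) (filter-map P? xs)
  ... | no _  = filter-map P? xs

Least : (ℕ → Set) → ℕ → Set
Least P m = P m × (∀ {k} → k < m → ¬ P k)

least : ∀ {P : ℕ → Set} → Decidable P → ∀ {d} → P d → ∃ (Least P)
least {P} P? = <-rec (λ d → P d → ∃ (Least P)) step _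
  where
  step : ∀ d → (∀ {k} → k < d → P k → ∃ (Least P)) → P d → ∃ (Least P)
  step d below Pd with anyUpTo? P? d
  ... | yes (k , k<d , Pk) = below k<d Pk
  ... | no none            = d , Pd , λ k<d Pk → none (_ , k<d , Pk)

toℕ-next-< : ∀ {t} (k : Fin t) → suc (toℕ k) < t → toℕ (next k) ≡ suc (toℕ k)
toℕ-next-< {suc m} k k+1<t with suc (toℕ k) <? suc m
... | yes k+1<t′ = toℕ-fromℕ< k+1<t′
... | no k+1≮t   = contradiction k+1<t k+1≮t

toℕ-next-last : ∀ {t} (k : Fin t) → suc (toℕ k) ≡ t → toℕ (next k) ≡ 0
toℕ-next-last {suc m} k k+1≡t with suc (toℕ k) <? suc m
... | yes k+1<t = contradiction k+1≡t (λ eq → <-irrefl eq k+1<t)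
... | no _      = refl

next-≢ : ∀ {t} → 2 ≤ t → (k : Fin t) → next k ≢ k
next-≢ 2≤t k next≡k with m≤n⇒m<n∨m≡n (toℕ<n k)
... | inj₁ k+1<t = 1+n≢n (trans (sym (toℕ-next-< k k+1<t)) (cong toℕ next≡k))
... | inj₂ k+1≡t = <-irrefl refl (subst (2 ≤_) (trans (sym k+1≡t) (cong suc k≡0)) 2≤t)
  where
  k≡0 : toℕ k ≡ 0
  k≡0 = trans (cong toℕ (sym next≡k)) (toℕ-next-last k k+1≡t)

next-surjective : ∀ {t} (j : Fin t) → ∃ λ i → next i ≡ j
next-surjective {suc m} zero =
  fromℕ m , toℕ-injective (toℕ-next-last (fromℕ m) (cong suc (toℕ-fromℕ m)))
next-surjective {suc m} (suc j) =
  inject₁ j , toℕ-injective (trans (toℕ-next-< (inject₁ j) j+1<m+1) (cong suc (toℕ-inject₁ j)))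
  where
  j+1<m+1 : suc (toℕ (inject₁ j)) < suc m
  j+1<m+1 = subst (λ l → suc l < suc m) (sym (toℕ-inject₁ j)) (s≤s (toℕ<n j))

toℕ-next-↑ˡ : ∀ {t s} → 1 ≤ s → (k : Fin t) → toℕ (next (k ↑ˡ s)) ≡ suc (toℕ k)
toℕ-next-↑ˡ {t} {s} 1≤s k = trans (toℕ-next-< (k ↑ˡ s) k+1<t+s) (cong suc (toℕ-↑ˡ k s))
  where
  k+1<t+s : suc (toℕ (k ↑ˡ s)) < t + s
  k+1<t+s = subst (λ l → suc l < t + s) (sym (toℕ-↑ˡ k s))
              (≤-trans (s≤s (toℕ<n k)) (subst (_≤ t + s) (+-comm t 1) (+-monoʳ-≤ t 1≤s)))

permutation-injective : ∀ {n} (p : Sym n) → Injective _≡_ _≡_ (p ⟨$⟩ʳ_)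
permutation-injective p = Injection.injective (↔⇒↣ p)

module Orbit {n} (p : Sym n) where

  iterate : ℕ → Fin n → Fin n
  iterate zero    i = i
  iterate (suc k) i = p ⟨$⟩ʳ iterate k i

  orbit : ∀ t → Fin n → Fin t → Fin n
  orbit t b k = iterate (toℕ k) b

  iterate-suc : ∀ k i → iterate k (p ⟨$⟩ʳ i) ≡ p ⟨$⟩ʳ iterate k i
  iterate-suc zero    i = refl
  iterate-suc (suc k) i = cong (p ⟨$⟩ʳ_) (iterate-suc k i)

  iterate-+ : ∀ a b i → iterate (a + b) i ≡ iterate a (iterate b i)
  iterate-+ zero    b i = refl
  iterate-+ (suc a) b i = cong (p ⟨$⟩ʳ_) (iterate-+ a b i)

  iterate-injective : ∀ k {i j} → iterate k i ≡ iterate k j → i ≡ j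
  iterate-injective zero    eq = eq
  iterate-injective (suc k) eq = iterate-injective k (permutation-injective p eq)

  iterate-moves : ∀ k {b} → p ⟨$⟩ʳ b ≢ b → p ⟨$⟩ʳ iterate k b ≢ iterate k b
  iterate-moves k p-moves-b eq = p-moves-b (iterate-injective k (trans (iterate-suc k _) eq))

  iterate-cancelʳ : ∀ d a b → iterate (d + a) b ≡ iterate a b → iterate d b ≡ b
  iterate-cancelʳ d a b eq = iterate-injective a (begin
    iterate a (iterate d b) ≡⟨ sym (iterate-+ a d b) ⟩
    iterate (a + d) b       ≡⟨ cong (λ l → iterate l b) (+-comm a d) ⟩
    iterate (d + a) b       ≡⟨ eq ⟩
    iterate a b             ∎)
    where open ≡-Reasoning

  eventually-returns : ∀ b → ∃ λ d → iterate (suc d) b ≡ b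
  eventually-returns b with pigeonhole (n<1+n n) (λ (k : Fin (suc n)) → iterate (toℕ k) b)
  ... | k₁ , k₂ , k₁<k₂ , eq with m≤n⇒∃[o]m+o≡n k₁<k₂
  ...   | d , k₁+1+d≡k₂ = d , iterate-cancelʳ (suc d) (toℕ k₁) b
          (trans (cong (λ l → iterate l b) d+1+k₁≡k₂) (sym eq))
    where
    d+1+k₁≡k₂ : suc d + toℕ k₁ ≡ toℕ k₂
    d+1+k₁≡k₂ = trans (cong suc (+-comm d (toℕ k₁))) k₁+1+d≡k₂

  record IsPeriod (b : Fin n) (t : ℕ) : Set where
    field
      returns : iterate t b ≡ b
      minimal : ∀ {k} → 0 < k → k < t → iterate k b ≢ b

  open IsPeriod public

  period : ∀ b → ∃ λ m → IsPeriod b (suc m)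
  period b with eventually-returns b
  ... | d , ret with least (λ m → iterate (suc m) b ≟ b) {d} ret
  ...   | m , ret′ , below = m , record { returns = ret′ ; minimal = no-earlier-return }
    where
    no-earlier-return : ∀ {k} → 0 < k → k < suc m → iterate k b ≢ b
    no-earlier-return {suc k} _ k<m = below (s≤s⁻¹ k<m)

  moved-period : ∀ {b} → p ⟨$⟩ʳ b ≢ b → ∃ λ m → IsPeriod b (2 + m)
  moved-period {b} p-moves-b with period b
  ... | zero  , per = contradiction (returns per) p-moves-b
  ... | suc m , per = m , per

  module _ {b t} (per : IsPeriod b t) where
    iterate-distinct : ∀ {j k} → j < k → k < t → iterate j b ≢ iterate k b
    iterate-distinct {j} j<k k<t eq with m≤n⇒∃[o]m+o≡n j<k
    ... | d , j+1+d≡k = minimal per z<s d+1<t (iterate-cancelʳ (suc d) j b d+1+j-returns)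
      where
      d+1+j≡k : suc d + j ≡ _
      d+1+j≡k = trans (cong suc (+-comm d j)) j+1+d≡k
      d+1<t : suc d < t
      d+1<t = ≤-<-trans (subst (suc d ≤_) d+1+j≡k (m≤m+n (suc d) j)) k<t
      d+1+j-returns : iterate (suc d + j) b ≡ iterate j b
      d+1+j-returns = trans (cong (λ l → iterate l b) d+1+j≡k) (sym eq)

    orbit-injectiveℕ : ∀ {j k} → j < t → k < t → iterate j b ≡ iterate k b → j ≡ k
    orbit-injectiveℕ {j} {k} j<t k<t eq with <-cmp j k
    ... | tri≈ _ j≡k _ = j≡k
    ... | tri< j<k _ _ = contradiction eq (iterate-distinct j<k k<t)
    ... | tri> _ _ k<j = contradiction (sym eq) (iterate-distinct k<j j<t)

    orbit-injective : Injective _≡_ _≡_ (orbit t b)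
    orbit-injective {j} {k} eq = toℕ-injective (orbit-injectiveℕ (toℕ<n j) (toℕ<n k) eq)

    orbit-isCycle : 2 ≤ t → IsCycle p (orbit t b)
    orbit-isCycle 2≤t = 2≤t , orbit-injective , step
      where
      step : ∀ k → p ⟨$⟩ʳ iterate (toℕ k) b ≡ iterate (toℕ (next k)) b
      step k with m≤n⇒m<n∨m≡n (toℕ<n k)
      ... | inj₁ k+1<t = cong (λ l → iterate l b) (sym (toℕ-next-< k k+1<t))
      ... | inj₂ k+1≡t = begin
        iterate (suc (toℕ k)) b      ≡⟨ cong (λ l → iterate l b) k+1≡t ⟩
        iterate t b                  ≡⟨ returns per ⟩
        b                            ≡⟨ cong (λ l → iterate l b) (sym (toℕ-next-last k k+1≡t)) ⟩
        iterate (toℕ (next k)) b     ∎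
        where open ≡-Reasoning

module _ {n} {σ : Sym n} where

  cycle-moves : ∀ {t} {z : Fin t → Fin n} → IsCycle σ z → ∀ k → σ ⟨$⟩ʳ z k ≢ z k
  cycle-moves (2≤t , z-injective , step) k eq = next-≢ 2≤t k (z-injective (trans (sym (step k)) eq))

  isCycle-transfer : ∀ {π : Sym n} {t} {z : Fin t → Fin n} →
                     IsCycle σ z → (∀ k → π ⟨$⟩ʳ z k ≡ σ ⟨$⟩ʳ z k) → IsCycle π z
  isCycle-transfer (2≤t , z-injective , step) agree = 2≤t , z-injective , λ k → trans (agree k) (step k)

  cycle-preimage : ∀ {t} {y : Fin t → Fin n} → IsCycle σ y →
                   ∀ {i j} → σ ⟨$⟩ʳ i ≡ y j → ∃ λ j′ → i ≡ y j′
  cycle-preimage {y = y} (_ , _ , step) {j = j} eq with next-surjective j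
  ... | j′ , next-j′≡j =
    j′ , permutation-injective σ (trans eq (trans (cong y (sym next-j′≡j)) (sym (step j′))))

  cycle-closed : ∀ {t} {y : Fin t → Fin n} → IsCycle σ y →
                 ∀ k {i j} → Orbit.iterate σ k i ≡ y j → ∃ λ j′ → i ≡ y j′
  cycle-closed y-cycle zero    eq = _ , eq
  cycle-closed y-cycle (suc k) eq = cycle-closed y-cycle k (proj₂ (cycle-preimage y-cycle eq))

moves? : ∀ {n} (p : Sym n) → Decidable (λ i → p ⟨$⟩ʳ i ≢ i)
moves? p i = ¬? (p ⟨$⟩ʳ i ≟ i)

∈-Tc⇔ : ∀ {n} (π : Sym n) {i j} → (i , j) ∈ Tc π ⇔ (π ⟨$⟩ʳ i ≢ i × π ⟨$⟩ʳ i ≡ j)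
∈-Tc⇔ π {i} = mk⇔ to from
  where
  to : ∀ {j} → (i , j) ∈ Tc π → π ⟨$⟩ʳ i ≢ i × π ⟨$⟩ʳ i ≡ j
  to ij∈ with ∈-map⁻ _ ij∈
  ... | _ , i∈ , refl = proj₂ (∈-filter⁻ (moves? π) {xs = allFin _} i∈) , refl
  from : ∀ {j} → π ⟨$⟩ʳ i ≢ i × π ⟨$⟩ʳ i ≡ j → (i , j) ∈ Tc π
  from (π-moves-i , refl) = ∈-map⁺ _ (∈-filter⁺ (moves? π) (∈-allFin i) π-moves-i)

record DeviatesOnlyAt {n} (π σ : Sym n) (a : Fin n) : Set where
  field
    moves    : σ ⟨$⟩ʳ a ≢ a
    deviates : π ⟨$⟩ʳ a ≢ σ ⟨$⟩ʳ a
    agrees   : ∀ {i} → σ ⟨$⟩ʳ i ≢ i → i ≢ a → π ⟨$⟩ʳ i ≡ σ ⟨$⟩ʳ i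

module Deviations {n} (π σ : Sym n) where

  agrees? : Decidable (λ i → π ⟨$⟩ʳ i ≡ σ ⟨$⟩ʳ i)
  agrees? i = π ⟨$⟩ʳ i ≟ σ ⟨$⟩ʳ i

  agreements deviations : ℕ
  agreements = length (filter (moves? σ ∩? agrees?) (allFin n))
  deviations = length (filter (moves? σ ∩? ∁? agrees?) (allFin n))

  TcInterCard≡agreements : TcInterCard σ π ≡ agreements
  TcInterCard≡agreements = begin
    length (filter (_∈? Tc π) (map graph (moved σ)))
      ≡⟨ cong length (filter-map graph (_∈? Tc π) (moved σ)) ⟩
    length (map graph (filter graph∈Tc? (moved σ)))
      ≡⟨ length-map graph (filter graph∈Tc? (moved σ)) ⟩
    length (filter graph∈Tc? (filter (moves? σ) (allFin n)))
      ≡⟨ cong length (filter-filter (moves? σ) graph∈Tc? (allFin n)) ⟩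
    length (filter (moves? σ ∩? graph∈Tc?) (allFin n))
      ≡⟨ cong length (filter-≐ _ _ (on-graph , from-graph) (allFin n)) ⟩
    agreements
      ∎
    where
    open ≡-Reasoning
    open DecMem (≡-dec _≟_ _≟_) using (_∈?_)
    graph : Fin n → Fin n × Fin n
    graph i = i , σ ⟨$⟩ʳ i
    graph∈Tc? : Decidable (λ i → graph i ∈ Tc π)
    graph∈Tc? i = graph i ∈? Tc π
    on-graph : ∀ {i} → σ ⟨$⟩ʳ i ≢ i × graph i ∈ Tc π →
               σ ⟨$⟩ʳ i ≢ i × π ⟨$⟩ʳ i ≡ σ ⟨$⟩ʳ i
    on-graph (σ-moves-i , i∈) = σ-moves-i , proj₂ (Equivalence.to (∈-Tc⇔ π) i∈)
    from-graph : ∀ {i} → σ ⟨$⟩ʳ i ≢ i × π ⟨$⟩ʳ i ≡ σ ⟨$⟩ʳ i →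
                 σ ⟨$⟩ʳ i ≢ i × graph i ∈ Tc π
    from-graph (σ-moves-i , eq) =
      σ-moves-i , Equivalence.from (∈-Tc⇔ π) ((λ π-fixes-i → σ-moves-i (trans (sym eq) π-fixes-i)) , eq)

  wH≡agreements+deviations : wH σ ≡ agreements + deviations
  wH≡agreements+deviations = length-filter-split (moves? σ) agrees? (allFin n)

  deviations≡1⇔deviatesOnce : deviations ≡ 1 ⇔ ∃ (DeviatesOnlyAt π σ)
  deviations≡1⇔deviatesOnce = mk⇔ to from
    where
    to : deviations ≡ 1 → ∃ (DeviatesOnlyAt π σ)
    to eq with length-filter≡1⇒unique (moves? σ ∩? ∁? agrees?) (allFin n) eq
    ... | a , (σ-moves-a , π-deviates-a) , only = a , record
      { moves    = σ-moves-a
      ; deviates = π-deviates-a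
      ; agrees   = λ {i} σ-moves-i i≢a → decidable-stable (agrees? i)
                     (λ π-deviates-i → i≢a (only (∈-allFin i) (σ-moves-i , π-deviates-i)))
      }
    from : ∃ (DeviatesOnlyAt π σ) → deviations ≡ 1
    from (a , dev) =
      trans (cong length (filter-≐ _ (_≟ a) (only-a , λ { refl → moves , deviates }) (allFin n)))
            (length-filter-≟ _≟_ (allFin⁺ n) (∈-allFin a))
      where
      open DeviatesOnlyAt dev
      only-a : ∀ {i} → σ ⟨$⟩ʳ i ≢ i × π ⟨$⟩ʳ i ≢ σ ⟨$⟩ʳ i → i ≡ a
      only-a {i} (σ-moves-i , π-deviates-i) =
        decidable-stable (i ≟ a) (λ i≢a → π-deviates-i (agrees σ-moves-i i≢a))

OneCycleTruncated : ∀ {n} → Sym n → Sym n → Set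
OneCycleTruncated {n} π σ =
  Σ ℕ λ t → Σ (Fin t → Fin n) λ y →
    IsCycle σ y
    × (∀ t′ (z : Fin t′ → Fin n) → IsCycle σ z → (∀ i j → z i ≢ y j) → IsCycle π z)
    × (Σ ℕ λ s → 1 ≤ s × (Σ (Fin (t + s) → Fin n) λ x →
         IsCycle π x × (∀ k → x (k ↑ˡ s) ≡ y k)))

module _ {n} {π σ : Sym n} {a} (dev : DeviatesOnlyAt π σ a) where
  open DeviatesOnlyAt dev
  private
    module S = Orbit σ
    module P = Orbit π

    b : Fin n
    b = σ ⟨$⟩ʳ a

    σ-moves-b : σ ⟨$⟩ʳ b ≢ b
    σ-moves-b eq = moves (permutation-injective σ eq)

    m : ℕ
    m = proj₁ (S.moved-period σ-moves-b)

    t : ℕ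
    t = 2 + m

    σ-period : S.IsPeriod b t
    σ-period = proj₂ (S.moved-period σ-moves-b)

    iterate-last : S.iterate (suc m) b ≡ a
    iterate-last = permutation-injective σ (S.returns σ-period)

    iterate-≢a : ∀ {j} → j < suc m → S.iterate j b ≢ a
    iterate-≢a j<m+1 eq = <-irrefl j≡m+1 j<m+1
      where
      j≡m+1 : _ ≡ suc m
      j≡m+1 = S.orbit-injectiveℕ σ-period (≤-trans j<m+1 (n≤1+n _)) ≤-refl (trans eq (sym iterate-last))

    π-follows-σ : ∀ {j} → j ≤ suc m → P.iterate j b ≡ S.iterate j b
    π-follows-σ {zero}  _       = refl
    π-follows-σ {suc j} j<m+1 = trans (cong (π ⟨$⟩ʳ_) (π-follows-σ (<⇒≤ j<m+1)))
                                      (agrees (S.iterate-moves j σ-moves-b) (iterate-≢a j<m+1))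

    π-returns-late : ∀ {k} → 0 < k → k ≤ t → P.iterate k b ≢ b
    π-returns-late {suc k} _ k<t with m≤n⇒m<n∨m≡n (s≤s⁻¹ k<t)
    ... | inj₁ k<m+1 = λ eq → S.minimal σ-period z<s (s≤s k<m+1) (trans (sym (π-follows-σ k<m+1)) eq)
    ... | inj₂ refl  = λ eq → deviates (trans (cong (π ⟨$⟩ʳ_) (sym π-reaches-a)) eq)
      where
      π-reaches-a : P.iterate (suc m) b ≡ a
      π-reaches-a = trans (π-follows-σ ≤-refl) iterate-last

    u : ℕ
    u = suc (proj₁ (P.period b))

    π-period : P.IsPeriod b u
    π-period = proj₂ (P.period b)

    t<u : t < u
    t<u = ≰⇒> (λ u≤t → π-returns-late z<s u≤t (P.returns π-period))

    s : ℕ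
    s = u ∸ t

    t+s≡u : t + s ≡ u
    t+s≡u = m+[n∸m]≡n (<⇒≤ t<u)

    y-last : S.orbit t b (fromℕ (suc m)) ≡ a
    y-last = trans (cong (λ l → S.iterate l b) (toℕ-fromℕ (suc m))) iterate-last

    others : ∀ t′ (z : Fin t′ → Fin n) → IsCycle σ z →
             (∀ i j → z i ≢ S.orbit t b j) → IsCycle π z
    others _ z z-cycle disjoint = isCycle-transfer {σ = σ} {π = π} z-cycle λ k →
      agrees (cycle-moves {σ = σ} z-cycle k) (λ zk≡a → disjoint k (fromℕ (suc m)) (trans zk≡a (sym y-last)))

    x-extends : ∀ k → P.orbit (t + s) b (k ↑ˡ s) ≡ S.orbit t b k
    x-extends k = trans (cong (λ l → P.iterate l b) (toℕ-↑ˡ k s)) (π-follows-σ (s≤s⁻¹ (toℕ<n k)))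

  deviatesOnlyAt⇒oneCycleTruncated : OneCycleTruncated π σ
  deviatesOnlyAt⇒oneCycleTruncated =
    t , S.orbit t b , S.orbit-isCycle σ-period (s≤s (s≤s z≤n)) , others ,
    s , m<n⇒0<n∸m t<u ,
    P.orbit (t + s) b ,
    P.orbit-isCycle (subst (P.IsPeriod b) (sym t+s≡u) π-period) (≤-trans (s≤s (s≤s z≤n)) (m≤m+n t s)) ,
    x-extends

module _ {n} {π σ : Sym n} {m} {y : Fin (suc m) → Fin n} (y-cycle : IsCycle σ y)
         (others : ∀ t′ (z : Fin t′ → Fin n) → IsCycle σ z → (∀ i j → z i ≢ y j) → IsCycle π z)
         {s} (1≤s : 1 ≤ s) {x : Fin (suc m + s) → Fin n} (x-cycle : IsCycle π x)
         (x-extends : ∀ k → x (k ↑ˡ s) ≡ y k) where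
  private
    module S = Orbit σ

    last : Fin (suc m)
    last = fromℕ m

    a : Fin n
    a = y last

    y-step : ∀ k → σ ⟨$⟩ʳ y k ≡ y (next k)
    y-step = proj₂ (proj₂ y-cycle)

    x-step : ∀ k → π ⟨$⟩ʳ x k ≡ x (next k)
    x-step = proj₂ (proj₂ x-cycle)

    x-injective : Injective _≡_ _≡_ x
    x-injective = proj₁ (proj₂ x-cycle)

    π-on-y : ∀ k → π ⟨$⟩ʳ y k ≡ x (next (k ↑ˡ s))
    π-on-y k = trans (cong (π ⟨$⟩ʳ_) (sym (x-extends k))) (x-step (k ↑ˡ s))

    next-↑ˡ : ∀ {j} → suc (toℕ j) < suc m → next (j ↑ˡ s) ≡ next j ↑ˡ s
    next-↑ˡ {j} j+1<m+1 = toℕ-injective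
      (trans (toℕ-next-↑ˡ 1≤s j) (sym (trans (toℕ-↑ˡ (next j) s) (toℕ-next-< j j+1<m+1))))

    -- π a = x (m + 1) lies beyond the copy of y in x, whereas σ a = y 0 = x 0.
    π-deviates : π ⟨$⟩ʳ a ≢ σ ⟨$⟩ʳ a
    π-deviates eq = 1+n≢0 (begin
      suc m                      ≡⟨ cong suc (sym (toℕ-fromℕ m)) ⟩
      suc (toℕ last)             ≡⟨ sym (toℕ-next-↑ˡ 1≤s last) ⟩
      toℕ (next (last ↑ˡ s))     ≡⟨ cong toℕ (x-injective x-next≡x-next) ⟩
      toℕ (next last ↑ˡ s)       ≡⟨ toℕ-↑ˡ (next last) s ⟩
      toℕ (next last)            ≡⟨ toℕ-next-last last (cong suc (toℕ-fromℕ m)) ⟩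
      0                          ∎)
      where
      open ≡-Reasoning
      x-next≡x-next : x (next (last ↑ˡ s)) ≡ x (next last ↑ˡ s)
      x-next≡x-next = trans (sym (π-on-y last)) (trans eq (trans (y-step last) (sym (x-extends (next last)))))

    agrees-on-y : ∀ j → y j ≢ a → π ⟨$⟩ʳ y j ≡ σ ⟨$⟩ʳ y j
    agrees-on-y j yj≢a = begin
      π ⟨$⟩ʳ y j            ≡⟨ π-on-y j ⟩
      x (next (j ↑ˡ s))     ≡⟨ cong x (next-↑ˡ (s≤s j<m)) ⟩
      x (next j ↑ˡ s)       ≡⟨ x-extends (next j) ⟩
      y (next j)            ≡⟨ sym (y-step j) ⟩
      σ ⟨$⟩ʳ y j            ∎
      where
      open ≡-Reasoning
      j<m : toℕ j < m
      j<m = ≤∧≢⇒< (s≤s⁻¹ (toℕ<n j))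
                  (λ j≡m → yj≢a (cong y (toℕ-injective (trans j≡m (sym (toℕ-fromℕ m))))))

    -- Off y, the σ-orbit of i is a σ-cycle disjoint from y, hence a π-cycle.
    agrees-off-y : ∀ {i} → σ ⟨$⟩ʳ i ≢ i → ¬ (∃ λ j → i ≡ y j) →
                   π ⟨$⟩ʳ i ≡ σ ⟨$⟩ʳ i
    agrees-off-y {i} σ-moves-i off-y =
      trans (proj₂ (proj₂ π-cycle) zero) (sym (proj₂ (proj₂ σ-cycle) zero))
      where
      m′ : ℕ
      m′ = proj₁ (S.moved-period σ-moves-i)
      σ-cycle : IsCycle σ (S.orbit (2 + m′) i)
      σ-cycle = S.orbit-isCycle (proj₂ (S.moved-period σ-moves-i)) (s≤s (s≤s z≤n))
      π-cycle : IsCycle π (S.orbit (2 + m′) i)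
      π-cycle = others _ _ σ-cycle (λ k j eq → off-y (cycle-closed y-cycle (toℕ k) eq))

  truncation⇒deviatesOnlyAt : DeviatesOnlyAt π σ a
  truncation⇒deviatesOnlyAt = record
    { moves    = cycle-moves {σ = σ} y-cycle last
    ; deviates = π-deviates
    ; agrees   = agrees
    }
    where
    agrees : ∀ {i} → σ ⟨$⟩ʳ i ≢ i → i ≢ a → π ⟨$⟩ʳ i ≡ σ ⟨$⟩ʳ i
    agrees {i} σ-moves-i i≢a with any? (λ j → i ≟ y j)
    ... | yes (j , refl) = agrees-on-y j i≢a
    ... | no off-y       = agrees-off-y σ-moves-i off-y

deviatesOnce⇔oneCycleTruncated : ∀ {n} {π σ : Sym n} → ∃ (DeviatesOnlyAt π σ) ⇔ OneCycleTruncated π σ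
deviatesOnce⇔oneCycleTruncated = mk⇔ (deviatesOnlyAt⇒oneCycleTruncated ∘ proj₂) from
  where
  from : ∀ {n} {π σ : Sym n} → OneCycleTruncated π σ → ∃ (DeviatesOnlyAt π σ)
  from (zero  , _ , (() , _) , _)
  from (suc m , y , y-cycle , others , s , 1≤s , x , x-cycle , x-extends) =
    _ , truncation⇒deviatesOnlyAt y-cycle others 1≤s x-cycle x-extends

N₃⇔deviations≡1 : ∀ {n} {π σ : Sym n} {r} → 1 ≤ r → wH σ ≡ r →
                  σ ∈N₃[ π , r ] ⇔ Deviations.deviations π σ ≡ 1
N₃⇔deviations≡1 {π = π} {σ} {r} 1≤r wHσ≡r = mk⇔ to from
  where
  open Deviations π σ
  open ≡-Reasoning
  r≡agreements+deviations : r ≡ agreements + deviations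
  r≡agreements+deviations = trans (sym wHσ≡r) wH≡agreements+deviations
  to : σ ∈N₃[ π , r ] → deviations ≡ 1
  to (inter≡r∸1 , _) = begin
    deviations                            ≡⟨ sym (m+n∸m≡n agreements deviations) ⟩
    agreements + deviations ∸ agreements  ≡⟨ cong₂ _∸_ (sym r≡agreements+deviations)
                                                      (trans (sym TcInterCard≡agreements) inter≡r∸1) ⟩
    r ∸ (r ∸ 1)                           ≡⟨ m∸[m∸n]≡n 1≤r ⟩
    1                                     ∎
  from : deviations ≡ 1 → σ ∈N₃[ π , r ]
  from deviations≡1 = inter≡r∸1 , trans (length-map _ (moved σ)) wHσ≡r
    where
    inter≡r∸1 : TcInterCard σ π ≡ r ∸ 1
    inter≡r∸1 = begin
      TcInterCard σ π              ≡⟨ TcInterCard≡agreements ⟩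
      agreements                   ≡⟨ sym (m+n∸n≡m agreements 1) ⟩
      agreements + 1 ∸ 1           ≡⟨ cong (λ d → agreements + d ∸ 1) (sym deviations≡1) ⟩
      agreements + deviations ∸ 1  ≡⟨ cong (_∸ 1) (sym r≡agreements+deviations) ⟩
      r ∸ 1                        ∎

lemma12 : ∀ {n} (r : ℕ) (π σ : Sym n) → 2 ≤ r →
          wH π ≡ 2 * r ∸ 1 → 2 * r ∸ 1 ≤ n → wH σ ≡ r →
          (σ ∈N₃[ π , r ]) ⇔
          (Σ ℕ λ t → Σ (Fin t → Fin n) λ y →
             IsCycle σ y
             × (∀ t′ (z : Fin t′ → Fin n) → IsCycle σ z → (∀ i j → z i ≢ y j) → IsCycle π z)
             × (Σ ℕ λ s → 1 ≤ s × (Σ (Fin (t + s) → Fin n) λ x →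
                  IsCycle π x × (∀ k → x (k ↑ˡ s) ≡ y k))))
lemma12 r π σ 2≤r _ _ wHσ≡r =
  deviatesOnce⇔oneCycleTruncated {π = π} {σ}
    ⇔-∘ (Deviations.deviations≡1⇔deviatesOnce π σ
    ⇔-∘ N₃⇔deviations≡1 {π = π} {σ} (≤-trans (s≤s z≤n) 2≤r) wHσ≡r)
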